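{- Let $(X,\mathcal{B})$ be a $t$-$(v,k,1)$-design with $k\ge 3t-2$. Then $(X,\mathcal{B})$ can be used as a distribution design to produce an RTS with threshold $3$; that is, there is a positive integer $\sigma$ such that the union of any $3$ distinct blocks contains at least $\sigma$ points and the union of any $2$ blocks contains at most $\sigma-1$ points.
   Context: A $t$-$(v,k,1)$-design is a set system $(X,\mathcal{B})$ with $|X|=v$, every block of size $k$, and every set of $t$ points of $X$ contained in exactly one block. A distribution design $(X,\mathcal{B})$ can be used to produce an RTS with threshold $\tau$ if there exists a positive integer $\sigma$ such that the union of any $\tau$ distinct blocks contains at least $\sigma$ points and the union of any $\tau-1$ blocks contains at most $\sigma-1$ points. -}

module Defs where

open import Data.Nat using (ℕ; _≡ᵇ_; _≤_; _<_; _*_; _∸_)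
open import Data.Fin using (Fin)
open import Data.Fin.Subset using (Subset; _⊆_; ∣_∣; _∪_)
open import Data.Product using (Σ; ∃; _×_)
open import Relation.Binary.PropositionalEquality using (_≡_)
open import Relation.Nullary using (¬_)
open import Function.Definitions using (Injective)

-- A t-(v,k,1)-design on the point set X = Fin v, with b blocks given as an
-- injective family B : Fin b → Subset v (so the blocks are pairwise distinct
-- sets, i.e. B describes a *set* of blocks).
record IsDesign (t v k b : ℕ) (B : Fin b → Subset v) : Set where
  field
    distinct   : Injective _≡_ _≡_ B
    blockSize  : ∀ i → ∣ B i ∣ ≡ k
    uniqueCover : ∀ (T : Subset v) → ∣ T ∣ ≡ t →
                  Σ (Fin b) (λ i → (T ⊆ B i) × (∀ j → T ⊆ B j → j ≡ i))

RTS3 : ∀ {v b} → (Fin b → Subset v) → Set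
RTS3 {v} {b} B =
  Σ ℕ λ σ → (1 ≤ σ)
    × (∀ i j l → ¬ i ≡ j → ¬ i ≡ l → ¬ j ≡ l → σ ≤ ∣ B i ∪ B j ∪ B l ∣)
    × (∀ i j → ∣ B i ∪ B j ∣ < σ)

module Submission where

-- Take σ = 2k + 1.  Any two blocks cover at most k + k points,
-- which is below σ.  For three distinct blocks A, B, C the Bonferroni
-- inequality gives
--     3k = |A| + |B| + |C| ≤ |A ∪ B ∪ C| + (|A ∩ B| + |A ∩ C| + |B ∩ C|),
-- and two distinct blocks share at most t - 1 points (t common points would
-- lie in a t-set covered by two different blocks), so
--     |A ∪ B ∪ C| ≥ 3k - 3(t - 1) ≥ 2k + 1   as soon as   3t - 2 ≤ k.

open import Defs
open import Data.Nat using (ℕ; _≤_; _*_; _∸_)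
open import Data.Fin using (Fin)
open import Data.Fin.Subset using (Subset)

open import Data.Nat using (zero; suc; _+_; _<_; z≤n; s≤s)
open import Data.Nat.Properties
open import Data.Nat.Tactic.RingSolver using (solve-∀)
open import Data.Vec using ([]; _∷_)
open import Data.Fin.Subset using (_⊆_; ∣_∣; _∪_; _∩_; ⊥; inside; outside)
open import Data.Fin.Subset.Properties
  using (out⊆; s⊆s; ⊆-min; ∣⊥∣≡0; p∩q⊆p; p∩q⊆q; ∩-distribˡ-∪)
open import Data.Product using (Σ; _×_; _,_)
open import Relation.Binary.PropositionalEquality
  using (_≡_; refl; sym; trans; cong; cong₂; module ≡-Reasoning)
open import Relation.Nullary using (¬_; yes; no; contradiction)

∣p∪q∣+∣p∩q∣≡∣p∣+∣q∣ : ∀ {n} (p q : Subset n) → ∣ p ∪ q ∣ + ∣ p ∩ q ∣ ≡ ∣ p ∣ + ∣ q ∣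
∣p∪q∣+∣p∩q∣≡∣p∣+∣q∣ []            []            = refl
∣p∪q∣+∣p∩q∣≡∣p∣+∣q∣ (outside ∷ p) (outside ∷ q) = ∣p∪q∣+∣p∩q∣≡∣p∣+∣q∣ p q
∣p∪q∣+∣p∩q∣≡∣p∣+∣q∣ (inside  ∷ p) (outside ∷ q) = cong suc (∣p∪q∣+∣p∩q∣≡∣p∣+∣q∣ p q)
∣p∪q∣+∣p∩q∣≡∣p∣+∣q∣ (outside ∷ p) (inside  ∷ q) =
  trans (cong suc (∣p∪q∣+∣p∩q∣≡∣p∣+∣q∣ p q)) (sym (+-suc (∣ p ∣) (∣ q ∣)))
∣p∪q∣+∣p∩q∣≡∣p∣+∣q∣ (inside  ∷ p) (inside  ∷ q) = cong suc (begin
  ∣ p ∪ q ∣ + suc ∣ p ∩ q ∣  ≡⟨ +-suc (∣ p ∪ q ∣) (∣ p ∩ q ∣) ⟩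
  suc (∣ p ∪ q ∣ + ∣ p ∩ q ∣) ≡⟨ cong suc (∣p∪q∣+∣p∩q∣≡∣p∣+∣q∣ p q) ⟩
  suc (∣ p ∣ + ∣ q ∣)        ≡⟨ +-suc (∣ p ∣) (∣ q ∣) ⟨
  ∣ p ∣ + suc ∣ q ∣          ∎)
  where open ≡-Reasoning

∣p∪q∣≤∣p∣+∣q∣ : ∀ {n} (p q : Subset n) → ∣ p ∪ q ∣ ≤ ∣ p ∣ + ∣ q ∣
∣p∪q∣≤∣p∣+∣q∣ p q =
  ≤-trans (m≤m+n (∣ p ∪ q ∣) (∣ p ∩ q ∣)) (≤-reflexive (∣p∪q∣+∣p∩q∣≡∣p∣+∣q∣ p q))

bonferroni₃ : ∀ {n} (p q r : Subset n) →
  ∣ p ∣ + ∣ q ∣ + ∣ r ∣ ≤ ∣ p ∪ q ∪ r ∣ + (∣ p ∩ q ∣ + ∣ p ∩ r ∣ + ∣ q ∩ r ∣)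
bonferroni₃ p q r = begin
  ∣ p ∣ + ∣ q ∣ + ∣ r ∣
    ≡⟨ +-assoc (∣ p ∣) (∣ q ∣) (∣ r ∣) ⟩
  ∣ p ∣ + (∣ q ∣ + ∣ r ∣)
    ≡⟨ cong (∣ p ∣ +_) (∣p∪q∣+∣p∩q∣≡∣p∣+∣q∣ q r) ⟨
  ∣ p ∣ + (∣ q ∪ r ∣ + ∣ q ∩ r ∣)
    ≡⟨ +-assoc (∣ p ∣) (∣ q ∪ r ∣) (∣ q ∩ r ∣) ⟨
  ∣ p ∣ + ∣ q ∪ r ∣ + ∣ q ∩ r ∣
    ≡⟨ cong (_+ ∣ q ∩ r ∣) (∣p∪q∣+∣p∩q∣≡∣p∣+∣q∣ p (q ∪ r)) ⟨
  ∣ p ∪ q ∪ r ∣ + ∣ p ∩ (q ∪ r) ∣ + ∣ q ∩ r ∣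
    ≡⟨ cong (λ s → ∣ p ∪ q ∪ r ∣ + ∣ s ∣ + ∣ q ∩ r ∣) (∩-distribˡ-∪ p q r) ⟩
  ∣ p ∪ q ∪ r ∣ + ∣ p ∩ q ∪ p ∩ r ∣ + ∣ q ∩ r ∣
    ≤⟨ +-monoˡ-≤ (∣ q ∩ r ∣) (+-monoʳ-≤ (∣ p ∪ q ∪ r ∣) (∣p∪q∣≤∣p∣+∣q∣ (p ∩ q) (p ∩ r))) ⟩
  ∣ p ∪ q ∪ r ∣ + (∣ p ∩ q ∣ + ∣ p ∩ r ∣) + ∣ q ∩ r ∣
    ≡⟨ +-assoc (∣ p ∪ q ∪ r ∣) _ (∣ q ∩ r ∣) ⟩
  ∣ p ∪ q ∪ r ∣ + (∣ p ∩ q ∣ + ∣ p ∩ r ∣ + ∣ q ∩ r ∣) ∎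
  where open ≤-Reasoning

subsetOfSize : ∀ {n} t (S : Subset n) → t ≤ ∣ S ∣ →
  Σ (Subset n) λ T → T ⊆ S × ∣ T ∣ ≡ t
subsetOfSize {n} zero  S             _           = ⊥ , ⊆-min S , ∣⊥∣≡0 n
subsetOfSize (suc t)   (outside ∷ S) t<∣S∣       with subsetOfSize (suc t) S t<∣S∣
... | T , T⊆S , ∣T∣≡t = outside ∷ T , out⊆ T⊆S , ∣T∣≡t
subsetOfSize (suc t)   (inside ∷ S)  (s≤s t≤∣S∣) with subsetOfSize t S t≤∣S∣
... | T , T⊆S , ∣T∣≡t = inside ∷ T , s⊆s T⊆S , cong suc ∣T∣≡t

-- In a t-(v,k,1)-design two distinct blocks meet in fewer than t points:
-- otherwise a t-set inside their intersection would lie in two blocks.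
distinctBlocksMeetInFewerThan : ∀ {t v k b} {B : Fin b → Subset v} →
  IsDesign t v k b B → ∀ i j → ¬ i ≡ j → ∣ B i ∩ B j ∣ < t
distinctBlocksMeetInFewerThan {t} {B = B} design i j i≢j
  with t ≤? ∣ B i ∩ B j ∣
... | no  t≰∣B∩B∣ = ≰⇒> t≰∣B∩B∣
... | yes t≤∣B∩B∣ with subsetOfSize t (B i ∩ B j) t≤∣B∩B∣
...   | T , T⊆B∩B , ∣T∣≡t with IsDesign.uniqueCover design T ∣T∣≡t
...     | _ , _ , onlyBlock = contradiction
            (trans (onlyBlock i (λ x∈T → p∩q⊆p (B i) (B j) (T⊆B∩B x∈T)))
                   (sym (onlyBlock j (λ x∈T → p∩q⊆q (B i) (B j) (T⊆B∩B x∈T)))))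
            i≢j

unionOfThreeExceeds : ∀ k t u a b c →
  k + k + k ≤ u + (a + b + c) → a < t → b < t → c < t → 3 * t ∸ 2 ≤ k →
  suc (k + k) ≤ u
unionOfThreeExceeds k t u a b c sizes≤ a<t b<t c<t 3t∸2≤k =
  +-cancelʳ-≤ (k + 2) (suc (k + k)) u (begin
    suc (k + k) + (k + 2)       ≡⟨ regroupLeft k ⟩
    k + k + k + 3               ≤⟨ +-monoˡ-≤ 3 sizes≤ ⟩
    u + (a + b + c) + 3         ≡⟨ regroupRight u a b c ⟩
    u + (suc a + (suc b + (suc c + 0)))
                                ≤⟨ +-monoʳ-≤ u (+-mono-≤ a<t (+-mono-≤ b<t (+-monoˡ-≤ 0 c<t))) ⟩
    u + 3 * t                   ≤⟨ +-monoʳ-≤ u 3t≤k+2 ⟩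
    u + (k + 2)                 ∎)
  where
  open ≤-Reasoning
  3t≤k+2 : 3 * t ≤ k + 2
  3t≤k+2 = ≤-trans (m≤n+m∸n (3 * t) 2)
                   (≤-trans (+-monoʳ-≤ 2 3t∸2≤k) (≤-reflexive (+-comm 2 k)))
  regroupLeft : ∀ k → suc (k + k) + (k + 2) ≡ k + k + k + 3
  regroupLeft = solve-∀
  regroupRight : ∀ u a b c → u + (a + b + c) + 3 ≡ u + (suc a + (suc b + (suc c + 0)))
  regroupRight = solve-∀

theorem3p2 : (t v k b : ℕ) (B : Fin b → Subset v) →
    IsDesign t v k b B → 3 * t ∸ 2 ≤ k → RTS3 B
theorem3p2 t v k b B design 3t∸2≤k =
  suc (k + k) , s≤s z≤n , threeBlocksCover , twoBlocksCover
  where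
  open IsDesign design using (blockSize)

  meet : ∀ i j → ¬ i ≡ j → ∣ B i ∩ B j ∣ < t
  meet = distinctBlocksMeetInFewerThan design

  sumOfSizes₂ : ∀ i j → ∣ B i ∣ + ∣ B j ∣ ≡ k + k
  sumOfSizes₂ i j = cong₂ _+_ (blockSize i) (blockSize j)

  twoBlocksCover : ∀ i j → ∣ B i ∪ B j ∣ < suc (k + k)
  twoBlocksCover i j =
    s≤s (≤-trans (∣p∪q∣≤∣p∣+∣q∣ (B i) (B j)) (≤-reflexive (sumOfSizes₂ i j)))

  threeBlocksCover : ∀ i j l → ¬ i ≡ j → ¬ i ≡ l → ¬ j ≡ l →
    suc (k + k) ≤ ∣ B i ∪ B j ∪ B l ∣
  threeBlocksCover i j l i≢j i≢l j≢l =
    unionOfThreeExceeds k t _ _ _ _ blockBonferroni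
      (meet i j i≢j) (meet i l i≢l) (meet j l j≢l) 3t∸2≤k
    where
    blockBonferroni : k + k + k ≤ ∣ B i ∪ B j ∪ B l ∣
             + (∣ B i ∩ B j ∣ + ∣ B i ∩ B l ∣ + ∣ B j ∩ B l ∣)
    blockBonferroni =
      ≤-trans (≤-reflexive (sym (cong₂ _+_ (sumOfSizes₂ i j) (blockSize l))))
              (bonferroni₃ (B i) (B j) (B l))
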